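{- There are infinitely many non-primitive Pythagorean triples $(x,y,z)$ such that exactly one of the three components $x,y,z$ is a numeric palindrome.
   Context: A Pythagorean triple is a triple $(x,y,z)$ of positive integers with $x^2+y^2=z^2$; it is primitive if $\gcd(x,y,z)=1$ and non-primitive otherwise. A numeric palindrome is a positive integer whose decimal representation (without leading zeros) reads the same forwards and backwards. -}

module Defs where

open import Data.Nat using (ℕ; zero; suc; _+_; _*_; _<_; _/_; _%_)
open import Data.Nat.GCD using (gcd)
open import Data.Nat.Induction using (<-wellFounded)
open import Data.Nat.DivMod using (m/n<m)
open import Data.Nat.Properties using (≤-refl)
open import Data.List using (List; []; _∷_; reverse)
open import Data.Product using (_×_)
open import Data.Sum using (_⊎_)
open import Relation.Nullary using (¬_)
open import Relation.Binary.PropositionalEquality using (_≡_; _≢_)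
open import Induction.WellFounded using (Acc; acc)

-- decimal digits, least significant first; digits 0 = []
digitsAcc : (n : ℕ) → Acc _<_ n → List ℕ
digitsAcc zero _ = []
digitsAcc (suc n) (acc rs) =
  (suc n % 10) ∷ digitsAcc (suc n / 10) (rs (m/n<m (suc n) 10 (Data.Nat.s≤s (Data.Nat.s≤s Data.Nat.z≤n))))

digits : ℕ → List ℕ
digits n = digitsAcc n (<-wellFounded n)

IsPalindrome : ℕ → Set
IsPalindrome n = (0 < n) × (reverse (digits n) ≡ digits n)

IsPythTriple : ℕ → ℕ → ℕ → Set
IsPythTriple x y z = (0 < x) × (0 < y) × (0 < z) × (x * x + y * y ≡ z * z)

NonPrimitive : ℕ → ℕ → ℕ → Set
NonPrimitive x y z = gcd (gcd x y) z ≢ 1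

ExactlyOne : Set → Set → Set → Set
ExactlyOne P Q R = (P × ¬ Q × ¬ R) ⊎ (¬ P × Q × ¬ R) ⊎ (¬ P × ¬ Q × R)

module Submission where

-- For m ≥ 0 put k = 1 + 10 ^ (2 + m) and take the multiple
-- (5k, 12k, 13k) of the triple (5, 12, 13).  For a decimal block B of
-- length ℓ, the number  B · (1 + 10 ^ (ℓ + m))  is written as B, then m
-- zeros, then B again.  Hence 5k, 12k and 13k read  5 0…0 5,  12 0…0 12
-- and  13 0…0 13, and such a repeated block is a palindrome exactly when
-- B is one: 5k is a palindrome while 12k and 13k are not.  The common
-- factor k ≠ 1 makes the triple non-primitive, and 13k grows with m.

open import Defs
open import Data.Nat using (ℕ; zero; suc; _+_; _*_; _^_; _<_; _≤_; z≤n; s≤s; _/_; _%_; _<?_)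
open import Data.Nat.Properties
open import Data.Nat.DivMod using ([m+kn]%n≡m%n; m<n⇒m%n≡m; +-distrib-/-∣ʳ; m<n⇒m/n≡0; m*n/n≡m)
open import Data.Nat.GCD using (gcd-greatest)
open import Data.Nat.Divisibility using (_∣_; divides; ∣1⇒≡1; n∣m*n)
open import Data.Nat.Induction using (<-wellFounded)
open import Induction.WellFounded using (Acc; acc)
open import Data.List using (List; []; _∷_; _∷ʳ_; _++_; reverse; replicate; length)
open import Data.List.Properties using (reverse-++; unfold-reverse; length-reverse; ++-assoc; ∷-injective)
open import Data.Product using (Σ; _×_; _,_)
open import Data.Sum using (inj₁)
open import Relation.Nullary using (¬_)
open import Relation.Nullary.Decidable using (True; toWitness)
open import Relation.Binary.PropositionalEquality
open import Data.Nat.Tactic.RingSolver using (solve-∀)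

digitsAcc-irrelevant : ∀ n (a b : Acc _<_ n) → digitsAcc n a ≡ digitsAcc n b
digitsAcc-irrelevant zero    _       _       = refl
digitsAcc-irrelevant (suc n) (acc r) (acc s) =
  cong (suc n % 10 ∷_) (digitsAcc-irrelevant (suc n / 10) _ _)

digits-positive : ∀ n → 0 < n → digits n ≡ n % 10 ∷ digits (n / 10)
digits-positive (suc n) _ with <-wellFounded (suc n)
... | acc r = cong (suc n % 10 ∷_) (digitsAcc-irrelevant (suc n / 10) _ _)

fromDigits : List ℕ → ℕ
fromDigits []      = 0
fromDigits (d ∷ L) = d + fromDigits L * 10

fromDigits-++ : ∀ A C → fromDigits (A ++ C) ≡ fromDigits A + fromDigits C * 10 ^ length A
fromDigits-++ []      C = sym (*-identityʳ (fromDigits C))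
fromDigits-++ (d ∷ A) C rewrite fromDigits-++ A C = shift d (fromDigits A) (fromDigits C) (10 ^ length A)
  where
  shift : ∀ d a c p → d + (a + c * p) * 10 ≡ d + a * 10 + c * (10 * p)
  shift = solve-∀

-- A canonical decimal representation: nonempty, every entry a digit,
-- and the most significant (last) digit nonzero.
data Canonical : List ℕ → Set where
  leading : ∀ {d} → 0 < d → d < 10 → Canonical (d ∷ [])
  _∷_     : ∀ {d L} → d < 10 → Canonical L → Canonical (d ∷ L)

digit : ∀ d → {True (d <? 10)} → d < 10
digit d {d<10} = toWitness d<10

canonical-++ : ∀ {A C} → Canonical A → Canonical C → Canonical (A ++ C)
canonical-++ (leading _ d<10) c = d<10 ∷ c
canonical-++ (d<10 ∷ a)       c = d<10 ∷ canonical-++ a c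

canonical-zeros : ∀ m {C} → Canonical C → Canonical (replicate m 0 ++ C)
canonical-zeros zero    c = c
canonical-zeros (suc m) c = s≤s z≤n ∷ canonical-zeros m c

fromDigits-positive : ∀ {L} → Canonical L → 0 < fromDigits L
fromDigits-positive (leading {d} 0<d _) = ≤-trans 0<d (m≤m+n d 0)
fromDigits-positive (_∷_ {d} {L} _ c)   =
  ≤-trans (≤-trans (fromDigits-positive c) (m≤m*n (fromDigits L) 10)) (m≤n+m _ d)

last-digit : ∀ d c → d < 10 → (d + c * 10) % 10 ≡ d
last-digit d c d<10 = trans ([m+kn]%n≡m%n d c 10) (m<n⇒m%n≡m d<10)

drop-last-digit : ∀ d c → d < 10 → (d + c * 10) / 10 ≡ c
drop-last-digit d c d<10 = begin
  (d + c * 10) / 10     ≡⟨ +-distrib-/-∣ʳ d (divides c refl) ⟩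
  d / 10 + c * 10 / 10  ≡⟨ cong₂ _+_ (m<n⇒m/n≡0 d<10) (m*n/n≡m c 10) ⟩
  c                     ∎
  where open ≡-Reasoning

digits-cons : ∀ {d} L → d < 10 → 0 < fromDigits (d ∷ L) →
              digits (fromDigits (d ∷ L)) ≡ d ∷ digits (fromDigits L)
digits-cons {d} L d<10 positive = begin
  digits (d + c * 10)                             ≡⟨ digits-positive _ positive ⟩
  (d + c * 10) % 10 ∷ digits ((d + c * 10) / 10)  ≡⟨ cong₂ _∷_ (last-digit d c d<10)
                                                       (cong digits (drop-last-digit d c d<10)) ⟩
  d ∷ digits c                                    ∎
  where
  open ≡-Reasoning
  c = fromDigits L

digits-fromDigits : ∀ {L} → Canonical L → digits (fromDigits L) ≡ L
digits-fromDigits         c@(leading _ d<10) = digits-cons [] d<10 (fromDigits-positive c)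
digits-fromDigits {_ ∷ L} c@(d<10 ∷ c′) =
  trans (digits-cons L d<10 (fromDigits-positive c)) (cong (_ ∷_) (digits-fromDigits c′))

doubled : List ℕ → ℕ → List ℕ
doubled B m = B ++ replicate m 0 ++ B

-- The number whose decimal representation is `doubled B m`.
repeated : List ℕ → ℕ → ℕ
repeated B m = fromDigits B * (1 + 10 ^ (length B + m))

fromDigits-zeros : ∀ m C → fromDigits (replicate m 0 ++ C) ≡ fromDigits C * 10 ^ m
fromDigits-zeros zero    C = sym (*-identityʳ (fromDigits C))
fromDigits-zeros (suc m) C rewrite fromDigits-zeros m C = shift (fromDigits C) (10 ^ m)
  where
  shift : ∀ c p → c * p * 10 ≡ c * (10 * p)
  shift = solve-∀

fromDigits-doubled : ∀ B m → fromDigits (doubled B m) ≡ repeated B m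
fromDigits-doubled B m = begin
  fromDigits (B ++ replicate m 0 ++ B)          ≡⟨ fromDigits-++ B (replicate m 0 ++ B) ⟩
  b + fromDigits (replicate m 0 ++ B) * 10 ^ ℓ  ≡⟨ cong (λ t → b + t * 10 ^ ℓ) (fromDigits-zeros m B) ⟩
  b + b * 10 ^ m * 10 ^ ℓ                       ≡⟨ collect b (10 ^ m) (10 ^ ℓ) ⟩
  b * (1 + 10 ^ ℓ * 10 ^ m)                     ≡⟨ cong (λ t → b * (1 + t)) (^-distribˡ-+-* 10 ℓ m) ⟨
  repeated B m                                  ∎
  where
  open ≡-Reasoning
  b = fromDigits B
  ℓ = length B
  collect : ∀ b p q → b + b * p * q ≡ b * (1 + q * p)
  collect = solve-∀

digits-repeated : ∀ {B} m → Canonical B → digits (repeated B m) ≡ doubled B m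
digits-repeated {B} m c = begin
  digits (repeated B m)             ≡⟨ cong digits (fromDigits-doubled B m) ⟨
  digits (fromDigits (doubled B m)) ≡⟨ digits-fromDigits (canonical-++ c (canonical-zeros m c)) ⟩
  doubled B m                       ∎
  where open ≡-Reasoning

reverse-zeros : ∀ m → reverse (replicate m 0) ≡ replicate m 0
reverse-zeros zero    = refl
reverse-zeros (suc m) = begin
  reverse (0 ∷ replicate m 0)  ≡⟨ unfold-reverse 0 (replicate m 0) ⟩
  reverse (replicate m 0) ∷ʳ 0 ≡⟨ cong (_∷ʳ 0) (reverse-zeros m) ⟩
  replicate m 0 ∷ʳ 0           ≡⟨ replicate-snoc m ⟩
  0 ∷ replicate m 0            ∎
  where
  open ≡-Reasoning
  replicate-snoc : ∀ m → replicate m 0 ∷ʳ 0 ≡ 0 ∷ replicate m 0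
  replicate-snoc zero    = refl
  replicate-snoc (suc m) = cong (0 ∷_) (replicate-snoc m)

reverse-doubled : ∀ B m → reverse (doubled B m) ≡ doubled (reverse B) m
reverse-doubled B m = begin
  reverse (B ++ Z ++ B)                 ≡⟨ reverse-++ B (Z ++ B) ⟩
  reverse (Z ++ B) ++ reverse B         ≡⟨ cong (_++ reverse B) (reverse-++ Z B) ⟩
  (reverse B ++ reverse Z) ++ reverse B ≡⟨ cong (λ t → (reverse B ++ t) ++ reverse B) (reverse-zeros m) ⟩
  (reverse B ++ Z) ++ reverse B         ≡⟨ ++-assoc (reverse B) Z (reverse B) ⟩
  reverse B ++ Z ++ reverse B           ∎
  where
  open ≡-Reasoning
  Z = replicate m 0

prefix-cancel : ∀ {A B C D : List ℕ} → length A ≡ length B → A ++ C ≡ B ++ D → A ≡ B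
prefix-cancel {[]}    {[]}    _   _  = refl
prefix-cancel {a ∷ A} {b ∷ B} len eq with ∷-injective eq
... | a≡b , rest = cong₂ _∷_ a≡b (prefix-cancel (suc-injective len) rest)

repeated-palindrome : ∀ {B} m → Canonical B → reverse B ≡ B → IsPalindrome (repeated B m)
repeated-palindrome {B} m c rev = positive , (begin
  reverse (digits (repeated B m)) ≡⟨ cong reverse (digits-repeated m c) ⟩
  reverse (doubled B m)           ≡⟨ reverse-doubled B m ⟩
  doubled (reverse B) m           ≡⟨ cong (λ t → doubled t m) rev ⟩
  doubled B m                     ≡⟨ digits-repeated m c ⟨
  digits (repeated B m)           ∎)
  where
  open ≡-Reasoning
  positive : 0 < repeated B m
  positive = subst (0 <_) (fromDigits-doubled B m)
    (fromDigits-positive (canonical-++ c (canonical-zeros m c)))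

-- Conversely, comparing the first |B| digits of a palindromic repeated
-- block with those of its reversal shows that B is a palindrome.
repeated-palindrome⁻¹ : ∀ {B} m → Canonical B → IsPalindrome (repeated B m) → reverse B ≡ B
repeated-palindrome⁻¹ {B} m c (_ , pal) = prefix-cancel (length-reverse B) (begin
  doubled (reverse B) m           ≡⟨ reverse-doubled B m ⟨
  reverse (doubled B m)           ≡⟨ cong reverse (digits-repeated m c) ⟨
  reverse (digits (repeated B m)) ≡⟨ pal ⟩
  digits (repeated B m)           ≡⟨ digits-repeated m c ⟩
  doubled B m                     ∎)
  where open ≡-Reasoning

scale-triple : ∀ {x y z} k → 0 < k → IsPythTriple x y z → IsPythTriple (x * k) (y * k) (z * k)
scale-triple {x} {y} {z} k 0<k (0<x , 0<y , 0<z , pyth) =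
  positive-product 0<x 0<k , positive-product 0<y 0<k , positive-product 0<z 0<k , scaled
  where
  open ≡-Reasoning
  positive-product : ∀ {m n} → 0 < m → 0 < n → 0 < m * n
  positive-product {suc m} {suc n} _ _ = s≤s z≤n
  square-product : ∀ x k → x * k * (x * k) ≡ k * k * (x * x)
  square-product = solve-∀
  scaled : x * k * (x * k) + y * k * (y * k) ≡ z * k * (z * k)
  scaled = begin
    x * k * (x * k) + y * k * (y * k)   ≡⟨ cong₂ _+_ (square-product x k) (square-product y k) ⟩
    k * k * (x * x) + k * k * (y * y)   ≡⟨ *-distribˡ-+ (k * k) (x * x) (y * y) ⟨
    k * k * (x * x + y * y)             ≡⟨ cong (k * k *_) pyth ⟩
    k * k * (z * z)                     ≡⟨ square-product z k ⟨
    z * k * (z * k)                     ∎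

common-factor-nonprimitive : ∀ {k x y z} → k ≢ 1 → k ∣ x → k ∣ y → k ∣ z → NonPrimitive x y z
common-factor-nonprimitive k≢1 k∣x k∣y k∣z gcd≡1 =
  k≢1 (∣1⇒≡1 (subst (_ ∣_) gcd≡1 (gcd-greatest (gcd-greatest k∣x k∣y) k∣z)))

n<10^n : ∀ n → n < 10 ^ n
n<10^n zero    = s≤s z≤n
n<10^n (suc n) = ≤-trans (s≤s (n<10^n n)) (successor-bound (10 ^ n) (m^n>0 10 n))
  where
  successor-bound : ∀ p → 1 ≤ p → suc p ≤ 10 * p
  successor-bound p 1≤p = ≤-trans (≤-reflexive (+-comm 1 p)) (+-monoʳ-≤ p (≤-trans 1≤p (m≤n*m p 9)))

theorem3p2 : (N : ℕ) → Σ ℕ λ x → Σ ℕ λ y → Σ ℕ λ z →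
    (N < z) × IsPythTriple x y z × NonPrimitive x y z ×
    ExactlyOne (IsPalindrome x) (IsPalindrome y) (IsPalindrome z)
theorem3p2 N = 5 * k , 12 * k , 13 * k , beyond ,
  scale-triple {5} {12} {13} k (s≤s z≤n) (s≤s z≤n , s≤s z≤n , s≤s z≤n , refl) ,
  common-factor-nonprimitive k≢1 (n∣m*n 5) (n∣m*n 12) (n∣m*n 13) ,
  inj₁ (palindrome-5k , ¬palindrome-12k , ¬palindrome-13k)
  where
  -- 5k, 12k, 13k are the repeated blocks  5 0…0 5,  12 0…0 12,  13 0…0 13
  k : ℕ
  k = 1 + 10 ^ (2 + N)
  palindrome-5k : IsPalindrome (5 * k)
  palindrome-5k = repeated-palindrome (suc N) (leading (s≤s z≤n) (digit 5)) refl
  ¬palindrome-12k : ¬ IsPalindrome (12 * k)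
  ¬palindrome-12k pal = 12-not-palindromic
    (repeated-palindrome⁻¹ N (digit 2 ∷ leading (s≤s z≤n) (digit 1)) pal)
    where
    12-not-palindromic : reverse (2 ∷ 1 ∷ []) ≢ 2 ∷ 1 ∷ []
    12-not-palindromic ()
  ¬palindrome-13k : ¬ IsPalindrome (13 * k)
  ¬palindrome-13k pal = 13-not-palindromic
    (repeated-palindrome⁻¹ N (digit 3 ∷ leading (s≤s z≤n) (digit 1)) pal)
    where
    13-not-palindromic : reverse (3 ∷ 1 ∷ []) ≢ 3 ∷ 1 ∷ []
    13-not-palindromic ()
  k≢1 : k ≢ 1
  k≢1 k≡1 = <⇒≢ (m^n>0 10 (2 + N)) (sym (suc-injective k≡1))
  beyond : N < 13 * k
  beyond = begin-strict
    N            <⟨ n<10^n N ⟩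
    10 ^ N       ≤⟨ ^-monoʳ-≤ 10 (m≤n+m N 2) ⟩
    10 ^ (2 + N) <⟨ n<1+n _ ⟩
    k            ≤⟨ m≤n*m k 13 ⟩
    13 * k       ∎
    where open ≤-Reasoning
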